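{- Let $G=(V,E)$ be an unweighted undirected graph and let $\mathcal{I}$ be the output of \textsc{GreedyMIS} on $G$. Then: (i) $\mathcal{I}$ is a maximal independent set of $G$; (ii) $V\setminus\mathcal{I}$ is a vertex cover of $G$ whose expected cardinality is at most $2$ times the minimum vertex cover size of $G$; (iii) using the nodes of $\mathcal{I}$ as pivots (the clustering in which each $v\in\mathcal{I}$, processed in the order of the permutation used by \textsc{GreedyMIS}, is clustered together with all its neighbors not already clustered) yields a clustering of $G$ whose expected number of mistakes is at most $3$ times the optimal \textsc{Correlation Clustering} value of $G$, and whose induced STC+ labeling has expected cost at most $3$ times the optimal \textsc{MinSTC+} value of $G$.
   Context: $N(v)$ denotes the neighbors of $v$. \textsc{GreedyMIS}$(G)$: set $\mathcal{I}\leftarrow\emptyset$, $\mathcal{U}\leftarrow V$; generate a uniformly random permutation of $V$; for each $v$ in this order: if $v\in\mathcal{U}$, add $v$ to $\mathcal{I}$ and remove $v$ and all of $N(v)\cap\mathcal{U}$ from $\mathcal{U}$. Return $\mathcal{I}$. \textsc{Correlation Clustering}: partition $V$ into any number of clusters to minimize the number of mistakes, where a mistake is either an edge $(i,j)\in E$ with $i,j$ in different clusters (positive mistake) or a non-adjacent pair $\{i,j\}$ with $i,j$ in the same cluster (negative mistake). An open wedge is a triple $\{u,v,w\}$ whose induced subgraph has exactly two edges, say $(u,v),(u,w)$ (centered at $u$). An STC+ labeling is a pair $(E_W,E_N)$ with $E_W\subseteq E$, $E_N\subseteq\binom{V}{2}\setminus E$ such that every open wedge centered at $u$ with edges $(u,v),(u,w)$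 has $(u,v)\in E_W$ or $(u,w)\in E_W$ or $\{v,w\}\in E_N$; \textsc{MinSTC+} asks to minimize $|E_W|+|E_N|$. A clustering induces the STC+ labeling with $E_W$ the positive mistakes and $E_N$ the negative mistakes. -}

module Defs where

open import Data.Nat using (ℕ; zero; suc; _+_; _*_; _<_; _<ᵇ_)
open import Data.Bool using (Bool; true; false; _∧_; _∨_; not; if_then_else_)
open import Data.Fin using (Fin; toℕ; _≟_)
open import Data.List using (List; []; _∷_; [_]; map; concatMap; foldl; length; allFin)
open import Data.Nat.ListAction using (sum)
open import Relation.Nullary.Decidable using (⌊_⌋)
open import Relation.Binary.PropositionalEquality using (_≡_)
open import Data.Sum using (_⊎_)
open import Data.Product using (Σ; ∃; _×_)

record Graph (n : ℕ) : Set where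
  field
    adj    : Fin n → Fin n → Bool
    sym    : ∀ i j → adj i j ≡ adj j i
    irrefl : ∀ i → adj i i ≡ false
open Graph public

_==_ : ∀ {n} → Fin n → Fin n → Bool
i == j = ⌊ i ≟ j ⌋

VSet : ℕ → Set
VSet n = Fin n → Bool

card : ∀ {n} → VSet n → ℕ
card {n} S = sum (map (λ i → if S i then 1 else 0) (allFin n))

-- number of unordered pairs {i,j} (i ≠ j, counted once via toℕ i < toℕ j)
-- satisfying a (symmetric) Boolean pair predicate
countPairs : ∀ {n} → (Fin n → Fin n → Bool) → ℕ
countPairs {n} P =
  sum (map (λ i → sum (map (λ j → if (toℕ i <ᵇ toℕ j) ∧ P i j then 1 else 0)
                           (allFin n)))
           (allFin n))

-- All orderings (permutations) of a list; the uniform random permutation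
-- of V is the uniform distribution on  perms (allFin n)

insertions : {A : Set} → A → List A → List (List A)
insertions x []       = [ x ∷ [] ]
insertions x (y ∷ ys) = (x ∷ y ∷ ys) ∷ map (y ∷_) (insertions x ys)

perms : {A : Set} → List A → List (List A)
perms []       = [ [] ]
perms (x ∷ xs) = concatMap (insertions x) (perms xs)

-- Sum of f over all permutations of V (= |perms| · E[f])
sumOverPerms : (n : ℕ) → (List (Fin n) → ℕ) → ℕ
sumOverPerms n f = sum (map f (perms (allFin n)))

numPerms : ℕ → ℕ
numPerms n = length (perms (allFin n))

record MISState (n : ℕ) : Set where
  constructor mis
  field
    U : VSet n
    I : VSet n

greedyStep : ∀ {n} → Graph n → MISState n → Fin n → MISState n
greedyStep G (mis U I) v =
  if U v
  then mis (λ x → U x ∧ not ((x == v) ∨ adj G v x))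
           (λ x → (x == v) ∨ I x)
  else mis U I

greedyMIS : ∀ {n} → Graph n → List (Fin n) → VSet n
greedyMIS {n} G order =
  MISState.I (foldl (greedyStep G) (mis (λ _ → true) (λ _ → false)) order)

-- A clustering is a labelling  Fin n → Fin n  (cluster id);
-- here the id of a cluster is its pivot.

record PivotState (n : ℕ) : Set where
  constructor piv
  field
    U   : VSet n
    lab : Fin n → Fin n

pivotStep : ∀ {n} → Graph n → PivotState n → Fin n → PivotState n
pivotStep G (piv U lab) v =
  if U v
  then piv (λ x → U x ∧ not ((x == v) ∨ adj G v x))
           (λ x → if U x ∧ ((x == v) ∨ adj G v x) then v else lab x)
  else piv U lab

pivotClustering : ∀ {n} → Graph n → List (Fin n) → (Fin n → Fin n)
pivotClustering {n} G order =
  PivotState.lab (foldl (pivotStep G) (piv (λ _ → true) (λ x → x)) order)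

Independent : ∀ {n} → Graph n → VSet n → Set
Independent G S = ∀ i j → S i ≡ true → S j ≡ true → adj G i j ≡ false

MaximalIndependent : ∀ {n} → Graph n → VSet n → Set
MaximalIndependent {n} G S =
  Independent G S ×
  (∀ v → S v ≡ false → ∃ λ (u : Fin n) → S u ≡ true × adj G u v ≡ true)

VertexCover : ∀ {n} → Graph n → VSet n → Set
VertexCover G C = ∀ i j → adj G i j ≡ true → C i ≡ true ⊎ C j ≡ true

complement : ∀ {n} → VSet n → VSet n
complement S i = not (S i)

-- Correlation clustering.  Any partition of V (into at most n clusters)
-- is given by a labelling  c : Fin n → Fin n.

positiveMistake : ∀ {n} → Graph n → (Fin n → Fin n) → Fin n → Fin n → Bool
positiveMistake G c i j = adj G i j ∧ not (c i == c j)

negativeMistake : ∀ {n} → Graph n → (Fin n → Fin n) → Fin n → Fin n → Bool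
negativeMistake G c i j = not (adj G i j) ∧ (c i == c j)

mistakes : ∀ {n} → Graph n → (Fin n → Fin n) → ℕ
mistakes G c =
  countPairs (positiveMistake G c) + countPairs (negativeMistake G c)

record STCPlus {n : ℕ} (G : Graph n) : Set where
  field
    W      : Fin n → Fin n → Bool
    N      : Fin n → Fin n → Bool
    W-sym  : ∀ i j → W i j ≡ W j i
    N-sym  : ∀ i j → N i j ≡ N j i
    W⊆E    : ∀ i j → W i j ≡ true → adj G i j ≡ true
    N⊆nonE : ∀ i j → N i j ≡ true → adj G i j ≡ false × (i == j) ≡ false
    wedge  : ∀ u v w → (v == w) ≡ false →
             adj G u v ≡ true → adj G u w ≡ true → adj G v w ≡ false →
             W u v ≡ true ⊎ W u w ≡ true ⊎ N v w ≡ true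
open STCPlus public

stcCost : ∀ {n} {G : Graph n} → STCPlus G → ℕ
stcCost L = countPairs (W L) + countPairs (N L)

inducedW : ∀ {n} → Graph n → (Fin n → Fin n) → Fin n → Fin n → Bool
inducedW = positiveMistake

inducedN : ∀ {n} → Graph n → (Fin n → Fin n) → Fin n → Fin n → Bool
inducedN G c i j = negativeMistake G c i j ∧ not (i == j)

inducedSTCCost : ∀ {n} → Graph n → (Fin n → Fin n) → ℕ
inducedSTCCost G c = countPairs (inducedW G c) + countPairs (inducedN G c)

private
  open import Relation.Binary.PropositionalEquality using (refl)
  _ : numPerms 4 ≡ 24
  _ = refl

module Submission where

-- GreedyMIS and the pivot clustering are one process along the order π: a vertex still
-- unclustered when reached becomes a pivot and removes its closed neighbourhood N[v]; the
-- MIS is the set of pivots and each vertex is labelled by the pivot that removed it.  Call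
-- v the pivot of a triple {a, b, c} if v is the first vertex of the triple in π and the
-- whole triple is still unclustered then.  A vertex outside the MIS has a neighbour that is
-- the pivot of their pair, and every clustering mistake {i, j} lies in an open wedge
-- {v, i, j} whose pivot is v.  For fixed i, j these events are disjoint over v, because the
-- first such pivot removes i or j; and relabelling π by a transposition shows that the
-- vertices of a triple are its pivot equally often.  Every STC+ labelling contains one of
-- the three pairs of each open wedge (every vertex cover an endpoint of each edge), and
-- charging to it bounds the sum over all n! orders by 3 (resp. 2) · n! times its cost.

open import Algebra using (CommutativeMonoid)
import Algebra.Properties.CommutativeSemigroup
open import Data.Bool using (Bool; true; false; _∧_; _∨_; not; if_then_else_)
open import Data.Bool.Properties
  using (∨-zeroʳ; ∨-identityʳ; ∧-zeroʳ; ∧-identityʳ; ∨-comm; ∧-comm; ∨-idem; ∧-idem; not-injective; ¬-not;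
         ∨-commutativeMonoid; ∧-commutativeMonoid)
open import Data.Empty using (⊥-elim)
open import Data.Fin using (Fin; toℕ; _≟_)
open import Data.Fin.Permutation using (Permutation; _⟨$⟩ʳ_; _⟨$⟩ˡ_; inverseˡ; inverseʳ)
import Data.Fin.Permutation as Permutation
open import Data.Fin.Permutation.Components using (transpose)
open import Data.Fin.Properties using (toℕ-injective)
open import Data.List using (List; []; _∷_; map; concatMap; length; foldl; allFin; _++_)
open import Data.List.Effectful using (module MonadProperties)
open import Data.List.Membership.Propositional using (_∈_; find)
open import Data.List.Membership.Propositional.Properties using (∈-allFin; ∈-map⁺; ∈-map⁻)
open import Data.List.Membership.Propositional.Properties.WithK using (unique∧set⇒bag)
open import Data.List.Properties using (map-∘; map-++; concatMap-map; map-concatMap; concatMap-cong)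
open import Data.List.Relation.Binary.BagAndSetEquality using (∼bag⇒↭)
open import Data.List.Relation.Binary.Permutation.Propositional
  using (_↭_; ↭-refl; ↭-sym; ↭-trans; prep; swap; module PermutationReasoning)
import Data.List.Relation.Binary.Permutation.Propositional as ↭
open import Data.List.Relation.Binary.Permutation.Propositional.Properties
  using (map⁺; ++⁺; ++⁺ˡ; shifts; ∈-resp-↭)
open import Data.List.Relation.Unary.All using (lookup)
open import Data.List.Relation.Unary.AllPairs using (_∷_)
open import Data.List.Relation.Unary.Any using (here; there)
import Data.List.Relation.Unary.Any.Properties as Any
open import Data.List.Relation.Unary.Unique.Propositional using (Unique)
import Data.List.Relation.Unary.Unique.Propositional.Properties as Unique
open import Data.Maybe using (Maybe; just; nothing)
import Data.Maybe as Maybe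
open import Data.Nat using (ℕ; suc; _+_; _*_; _≤_; _<_; _<ᵇ_; _<?_; z≤n; s≤s)
open import Data.Nat.ListAction using (sum)
open import Data.Nat.ListAction.Properties using (sum-↭)
open import Data.Nat.Properties hiding (_≟_)
open import Data.Nat.Solver using (module +-*-Solver)
open import Data.Product using (_×_; _,_; proj₁; proj₂; ∃)
open import Data.Sum using (_⊎_; inj₁; inj₂)
import Data.Sum as Sum
open import Function using (_∘_)
open import Function.Bundles using (mk⇔)
open import Relation.Binary.Definitions using (tri<; tri≈; tri>)
open import Relation.Binary.PropositionalEquality
open import Relation.Nullary using (yes; no)
open import Relation.Nullary.Decidable using (dec-true; dec-false)
open import Defs hiding (sym)

open +-*-Solver using (solve; _:+_; _:*_; _:=_; con)
open Algebra.Properties.CommutativeSemigroup +-commutativeSemigroup using () renaming (interchange to +-interchange)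
open Algebra.Properties.CommutativeSemigroup (CommutativeMonoid.commutativeSemigroup ∨-commutativeMonoid)
  using () renaming (x∙yz≈y∙xz to ∨-swapˡ)
open Algebra.Properties.CommutativeSemigroup (CommutativeMonoid.commutativeSemigroup ∧-commutativeMonoid)
  using () renaming (x∙yz≈y∙xz to ∧-swapˡ)

private variable
  A B : Set

-- Orderings of a list

concatMap-cong-↭ : {f g : A → List B} (xs : List A) → (∀ x → f x ↭ g x) → concatMap f xs ↭ concatMap g xs
concatMap-cong-↭ []       f↭g = ↭-refl
concatMap-cong-↭ (x ∷ xs) f↭g = ++⁺ (f↭g x) (concatMap-cong-↭ xs f↭g)

concatMap-↭ : (f : A → List B) {xs ys : List A} → xs ↭ ys → concatMap f xs ↭ concatMap f ys
concatMap-↭ f ↭.refl         = ↭-refl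
concatMap-↭ f (prep x p)     = ++⁺ˡ (f x) (concatMap-↭ f p)
concatMap-↭ f (swap x y p)   = ↭-trans (shifts (f x) (f y)) (++⁺ˡ (f y) (++⁺ˡ (f x) (concatMap-↭ f p)))
concatMap-↭ f (↭.trans p q)  = ↭-trans (concatMap-↭ f p) (concatMap-↭ f q)

concatMap-insertions-∷ : (x z : A) (ls : List (List A)) →
  concatMap (insertions x) (map (z ∷_) ls) ↭ map (x ∷_) (map (z ∷_) ls) ++ map (z ∷_) (concatMap (insertions x) ls)
concatMap-insertions-∷ x z []       = ↭-refl
concatMap-insertions-∷ {A = A} x z (l ∷ ls) = prep (x ∷ z ∷ l) (begin
  I ++ concatMap (insertions x) (map (z ∷_) ls)     ↭⟨ ++⁺ˡ I (concatMap-insertions-∷ x z ls) ⟩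
  I ++ (M ++ map (z ∷_) C)                           ↭⟨ shifts I M ⟩
  M ++ (I ++ map (z ∷_) C)                           ≡⟨ cong (M ++_) (map-++ (z ∷_) (insertions x l) C) ⟨
  M ++ map (z ∷_) (insertions x l ++ C)              ∎)
  where
  open PermutationReasoning
  I M C : List (List A)
  I = map (z ∷_) (insertions x l)
  M = map (x ∷_) (map (z ∷_) ls)
  C = concatMap (insertions x) ls

insertions-comm : (x y : A) (l : List A) →
  concatMap (insertions x) (insertions y l) ↭ concatMap (insertions y) (insertions x l)
insertions-comm x y []       = swap (x ∷ y ∷ []) (y ∷ x ∷ []) ↭-refl
insertions-comm {A = A} x y (z ∷ zs) = begin
  concatMap (insertions x) (insertions y (z ∷ zs))
    ↭⟨ prep _ (prep _ (++⁺ˡ P (concatMap-insertions-∷ x z (insertions y zs)))) ⟩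
  (x ∷ y ∷ z ∷ zs) ∷ (y ∷ x ∷ z ∷ zs) ∷ P ++ Q ++ map (z ∷_) (concatMap (insertions x) (insertions y zs))
    ↭⟨ prep _ (prep _ (++⁺ˡ P (++⁺ˡ Q (map⁺ (z ∷_) (insertions-comm x y zs))))) ⟩
  (x ∷ y ∷ z ∷ zs) ∷ (y ∷ x ∷ z ∷ zs) ∷ P ++ Q ++ R
    ↭⟨ swap _ _ (shifts P Q) ⟩
  (y ∷ x ∷ z ∷ zs) ∷ (x ∷ y ∷ z ∷ zs) ∷ Q ++ P ++ R
    ↭⟨ prep _ (prep _ (++⁺ˡ Q (concatMap-insertions-∷ y z (insertions x zs)))) ⟨
  concatMap (insertions y) (insertions x (z ∷ zs)) ∎
  where
  open PermutationReasoning
  P Q R : List (List A)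
  P = map (y ∷_) (map (z ∷_) (insertions x zs))
  Q = map (x ∷_) (map (z ∷_) (insertions y zs))
  R = map (z ∷_) (concatMap (insertions y) (insertions x zs))

perms-↭ : {xs ys : List A} → xs ↭ ys → perms xs ↭ perms ys
perms-↭ ↭.refl                       = ↭-refl
perms-↭ (prep x p)                   = concatMap-↭ (insertions x) (perms-↭ p)
perms-↭ {xs = x ∷ y ∷ xs} {y ∷ x ∷ ys} (swap x y p) = begin
  concatMap (insertions x) (concatMap (insertions y) (perms xs))
    ≡⟨ MonadProperties.associative (perms xs) (insertions y) (insertions x) ⟨
  concatMap (λ l → concatMap (insertions x) (insertions y l)) (perms xs)
    ↭⟨ concatMap-cong-↭ (perms xs) (insertions-comm x y) ⟩
  concatMap (λ l → concatMap (insertions y) (insertions x l)) (perms xs)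
    ↭⟨ concatMap-↭ _ (perms-↭ p) ⟩
  concatMap (λ l → concatMap (insertions y) (insertions x l)) (perms ys)
    ≡⟨ MonadProperties.associative (perms ys) (insertions x) (insertions y) ⟩
  concatMap (insertions y) (concatMap (insertions x) (perms ys)) ∎
  where open PermutationReasoning
perms-↭ (↭.trans p q)                = ↭-trans (perms-↭ p) (perms-↭ q)

∈-insertions⇒↭ : (x : A) (ys : List A) {l : List A} → l ∈ insertions x ys → l ↭ x ∷ ys
∈-insertions⇒↭ x []       (here refl) = ↭-refl
∈-insertions⇒↭ x (y ∷ ys) (here refl) = ↭-refl
∈-insertions⇒↭ x (y ∷ ys) (there p) with _ , q , refl ← ∈-map⁻ (y ∷_) p =
  ↭-trans (prep y (∈-insertions⇒↭ x ys q)) (swap y x ↭-refl)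

∈-perms⇒↭ : (xs : List A) {l : List A} → l ∈ perms xs → l ↭ xs
∈-perms⇒↭ []       (here refl) = ↭-refl
∈-perms⇒↭ (x ∷ xs) p with _ , q , r ← find (Any.concatMap⁻ (insertions x) p) =
  ↭-trans (∈-insertions⇒↭ x _ r) (prep x (∈-perms⇒↭ xs q))

insertions-map : (σ : A → B) (x : A) (ys : List A) →
  insertions (σ x) (map σ ys) ≡ map (map σ) (insertions x ys)
insertions-map σ x []       = refl
insertions-map σ x (y ∷ ys) = cong (map σ (x ∷ y ∷ ys) ∷_) (begin
  map (σ y ∷_) (insertions (σ x) (map σ ys))     ≡⟨ cong (map (σ y ∷_)) (insertions-map σ x ys) ⟩
  map (σ y ∷_) (map (map σ) (insertions x ys))   ≡⟨ map-∘ (insertions x ys) ⟨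
  map (map σ ∘ (y ∷_)) (insertions x ys)          ≡⟨ map-∘ (insertions x ys) ⟩
  map (map σ) (map (y ∷_) (insertions x ys))     ∎)
  where open ≡-Reasoning

perms-map : (σ : A → B) (xs : List A) → perms (map σ xs) ≡ map (map σ) (perms xs)
perms-map σ []       = refl
perms-map σ (x ∷ xs) = begin
  concatMap (insertions (σ x)) (perms (map σ xs))           ≡⟨ cong (concatMap (insertions (σ x))) (perms-map σ xs) ⟩
  concatMap (insertions (σ x)) (map (map σ) (perms xs))     ≡⟨ concatMap-map (insertions (σ x)) (map σ) (perms xs) ⟩
  concatMap (insertions (σ x) ∘ map σ) (perms xs)           ≡⟨ concatMap-cong (insertions-map σ x) (perms xs) ⟩
  concatMap (map (map σ) ∘ insertions x) (perms xs)         ≡⟨ map-concatMap (map σ) (insertions x) (perms xs) ⟨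
  map (map σ) (concatMap (insertions x) (perms xs))         ∎
  where open ≡-Reasoning

map-allFin-↭ : ∀ {n} (ρ : Permutation n n) → map (ρ ⟨$⟩ʳ_) (allFin n) ↭ allFin n
map-allFin-↭ {n} ρ = ∼bag⇒↭ (unique∧set⇒bag (Unique.map⁺ injective (Unique.allFin⁺ n)) (Unique.allFin⁺ n)
  (λ {i} → mk⇔ (λ _ → ∈-allFin i) (λ _ → subst (_∈ map (ρ ⟨$⟩ʳ_) (allFin n)) (inverseʳ ρ)
                                                (∈-map⁺ (ρ ⟨$⟩ʳ_) (∈-allFin (ρ ⟨$⟩ˡ i))))))
  where
  injective : ∀ {i j} → ρ ⟨$⟩ʳ i ≡ ρ ⟨$⟩ʳ j → i ≡ j
  injective {i} {j} eq = trans (sym (inverseˡ ρ)) (trans (cong (ρ ⟨$⟩ˡ_) eq) (inverseˡ ρ))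

sumOverPerms-relabel : ∀ n (ρ : Permutation n n) (f : List (Fin n) → ℕ) →
  sumOverPerms n (f ∘ map (ρ ⟨$⟩ʳ_)) ≡ sumOverPerms n f
sumOverPerms-relabel n ρ f = begin
  sum (map (f ∘ map (ρ ⟨$⟩ʳ_)) (perms (allFin n)))
    ≡⟨ cong sum (map-∘ (perms (allFin n))) ⟩
  sum (map f (map (map (ρ ⟨$⟩ʳ_)) (perms (allFin n))))
    ≡⟨ cong (sum ∘ map f) (perms-map (ρ ⟨$⟩ʳ_) (allFin n)) ⟨
  sum (map f (perms (map (ρ ⟨$⟩ʳ_) (allFin n))))
    ≡⟨ sum-↭ (map⁺ f (perms-↭ (map-allFin-↭ ρ))) ⟩
  sum (map f (perms (allFin n)))
    ∎
  where open ≡-Reasoning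

-- Finite sums

∑ : List A → (A → ℕ) → ℕ
∑ xs f = sum (map f xs)

⟦_⟧ : Bool → ℕ
⟦ b ⟧ = if b then 1 else 0

⟦∧⟧ : ∀ a b → ⟦ a ∧ b ⟧ ≡ ⟦ a ⟧ * ⟦ b ⟧
⟦∧⟧ true  b = sym (+-identityʳ ⟦ b ⟧)
⟦∧⟧ false b = refl

∑-cong : (xs : List A) {f g : A → ℕ} → (∀ x → f x ≡ g x) → ∑ xs f ≡ ∑ xs g
∑-cong []       f≡g = refl
∑-cong (x ∷ xs) f≡g = cong₂ _+_ (f≡g x) (∑-cong xs f≡g)

∑-mono : (xs : List A) {f g : A → ℕ} → (∀ x → x ∈ xs → f x ≤ g x) → ∑ xs f ≤ ∑ xs g
∑-mono []       f≤g = z≤n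
∑-mono (x ∷ xs) f≤g = +-mono-≤ (f≤g x (here refl)) (∑-mono xs (λ y y∈xs → f≤g y (there y∈xs)))

∑-zero : (xs : List A) → ∑ xs (λ _ → 0) ≡ 0
∑-zero []       = refl
∑-zero (x ∷ xs) = ∑-zero xs

∑-+ : (xs : List A) (f g : A → ℕ) → ∑ xs (λ x → f x + g x) ≡ ∑ xs f + ∑ xs g
∑-+ []       f g = refl
∑-+ (x ∷ xs) f g = begin
  (f x + g x) + ∑ xs (λ x → f x + g x)  ≡⟨ cong (f x + g x +_) (∑-+ xs f g) ⟩
  (f x + g x) + (∑ xs f + ∑ xs g)        ≡⟨ +-interchange (f x) (g x) (∑ xs f) (∑ xs g) ⟩
  (f x + ∑ xs f) + (g x + ∑ xs g)        ∎
  where open ≡-Reasoning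

∑-*ˡ : (xs : List A) (k : ℕ) (f : A → ℕ) → ∑ xs (λ x → k * f x) ≡ k * ∑ xs f
∑-*ˡ []       k f = sym (*-zeroʳ k)
∑-*ˡ (x ∷ xs) k f = trans (cong (k * f x +_) (∑-*ˡ xs k f)) (sym (*-distribˡ-+ k (f x) (∑ xs f)))

∑-*ʳ : (xs : List A) (k : ℕ) (f : A → ℕ) → ∑ xs (λ x → f x * k) ≡ ∑ xs f * k
∑-*ʳ xs k f = trans (∑-cong xs (λ x → *-comm (f x) k)) (trans (∑-*ˡ xs k f) (*-comm k (∑ xs f)))

∑-comm : (xs : List A) (ys : List B) (f : A → B → ℕ) →
  ∑ xs (λ x → ∑ ys (f x)) ≡ ∑ ys (λ y → ∑ xs (λ x → f x y))
∑-comm []       ys f = sym (∑-zero ys)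
∑-comm (x ∷ xs) ys f =
  trans (cong (∑ ys (f x) +_) (∑-comm xs ys f)) (sym (∑-+ ys (f x) (λ y → ∑ xs (λ x → f x y))))

∑-⟦⟧-≥1 : (xs : List A) (p : A → Bool) {x : A} → x ∈ xs → p x ≡ true → 1 ≤ ∑ xs (λ x → ⟦ p x ⟧)
∑-⟦⟧-≥1 (x ∷ xs) p (here refl) px rewrite px = s≤s z≤n
∑-⟦⟧-≥1 (y ∷ xs) p (there x∈xs) px = ≤-trans (∑-⟦⟧-≥1 xs p x∈xs px) (m≤n+m _ ⟦ p y ⟧)

∑-⟦⟧-≡0 : (xs : List A) (p : A → Bool) → (∀ x → x ∈ xs → p x ≡ false) → ∑ xs (λ x → ⟦ p x ⟧) ≡ 0
∑-⟦⟧-≡0 []       p none = refl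
∑-⟦⟧-≡0 (x ∷ xs) p none rewrite none x (here refl) = ∑-⟦⟧-≡0 xs p (λ y y∈xs → none y (there y∈xs))

∑-⟦⟧-≤1 : (xs : List A) (p : A → Bool) → Unique xs →
  (∀ x y → p x ≡ true → p y ≡ true → x ≡ y) → ∑ xs (λ x → ⟦ p x ⟧) ≤ 1
∑-⟦⟧-≤1 []       p _            _   = z≤n
∑-⟦⟧-≤1 (x ∷ xs) p (x∉xs ∷ uxs) one with p x in px
... | false = ∑-⟦⟧-≤1 xs p uxs one
... | true  = ≤-reflexive (cong suc (∑-⟦⟧-≡0 xs p none))
  where
  none : ∀ y → y ∈ xs → p y ≡ false
  none y y∈xs with p y in py
  ... | false = refl
  ... | true  = ⊥-elim (lookup x∉xs y∈xs (one x y px py))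

∑-≤-length : (xs : List A) (f : A → ℕ) → (∀ x → f x ≤ 1) → ∑ xs f ≤ length xs
∑-≤-length []       f f≤1 = z≤n
∑-≤-length (x ∷ xs) f f≤1 = +-mono-≤ (f≤1 x) (∑-≤-length xs f f≤1)

∑-⟦∧⟧ : (xs : List A) (ys : List B) (b : B → Bool) (e : A → B → Bool) →
  ∑ xs (λ x → ∑ ys (λ y → ⟦ b y ∧ e x y ⟧)) ≡ ∑ ys (λ y → ⟦ b y ⟧ * ∑ xs (λ x → ⟦ e x y ⟧))
∑-⟦∧⟧ xs ys b e = trans (∑-comm xs ys (λ x y → ⟦ b y ∧ e x y ⟧))
  (∑-cong ys (λ y → trans (∑-cong xs (λ x → ⟦∧⟧ (b y) (e x y))) (∑-*ˡ xs ⟦ b y ⟧ (λ x → ⟦ e x y ⟧))))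

∑-disjoint-≤ : (xs : List A) (ys : List B) (b : B → Bool) (e : A → B → Bool) → Unique ys →
  (∀ x y y′ → b y ∧ e x y ≡ true → b y′ ∧ e x y′ ≡ true → y ≡ y′) →
  ∑ ys (λ y → ⟦ b y ⟧ * ∑ xs (λ x → ⟦ e x y ⟧)) ≤ length xs
∑-disjoint-≤ xs ys b e uys disjoint = begin
  ∑ ys (λ y → ⟦ b y ⟧ * ∑ xs (λ x → ⟦ e x y ⟧))
    ≡⟨ ∑-⟦∧⟧ xs ys b e ⟨
  ∑ xs (λ x → ∑ ys (λ y → ⟦ b y ∧ e x y ⟧))
    ≤⟨ ∑-≤-length xs _ (λ x → ∑-⟦⟧-≤1 ys _ uys (disjoint x)) ⟩
  length xs
    ∎
  where open ≤-Reasoning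

<ᵇ-true : ∀ {m n} → m < n → (m <ᵇ n) ≡ true
<ᵇ-true {m} {n} = dec-true (m <? n)

<ᵇ-false : ∀ {m n} → n ≤ m → (m <ᵇ n) ≡ false
<ᵇ-false {m} {n} n≤m = dec-false (m <? n) (≤⇒≯ n≤m)

module _ {n : ℕ} where

  ∑₂ : (Fin n → Fin n → ℕ) → ℕ
  ∑₂ f = ∑ (allFin n) λ i → ∑ (allFin n) (f i)

  ∑₂-cong : {f g : Fin n → Fin n → ℕ} → (∀ i j → f i j ≡ g i j) → ∑₂ f ≡ ∑₂ g
  ∑₂-cong f≡g = ∑-cong (allFin n) λ i → ∑-cong (allFin n) (f≡g i)

  ∑₂-mono : {f g : Fin n → Fin n → ℕ} → (∀ i j → f i j ≤ g i j) → ∑₂ f ≤ ∑₂ g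
  ∑₂-mono f≤g = ∑-mono (allFin n) λ i _ → ∑-mono (allFin n) λ j _ → f≤g i j

  ∑₂-+ : (f g : Fin n → Fin n → ℕ) → ∑₂ (λ i j → f i j + g i j) ≡ ∑₂ f + ∑₂ g
  ∑₂-+ f g = trans (∑-cong (allFin n) λ i → ∑-+ (allFin n) (f i) (g i)) (∑-+ (allFin n) _ _)

  ∑₂-flip : (f : Fin n → Fin n → ℕ) → ∑₂ (λ i j → f j i) ≡ ∑₂ f
  ∑₂-flip f = ∑-comm (allFin n) (allFin n) λ i j → f j i

  ∑₃ : (Fin n → Fin n → Fin n → ℕ) → ℕ
  ∑₃ f = ∑ (allFin n) λ i → ∑₂ (f i)

  ∑₃-mono : {f g : Fin n → Fin n → Fin n → ℕ} → (∀ i j k → f i j k ≤ g i j k) → ∑₃ f ≤ ∑₃ g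
  ∑₃-mono f≤g = ∑-mono (allFin n) λ i _ → ∑₂-mono (f≤g i)

  ∑₃-+ : (f g : Fin n → Fin n → Fin n → ℕ) → ∑₃ (λ i j k → f i j k + g i j k) ≡ ∑₃ f + ∑₃ g
  ∑₃-+ f g = trans (∑-cong (allFin n) λ i → ∑₂-+ (f i) (g i)) (∑-+ (allFin n) _ _)

  ∑₃-rotate : (f : Fin n → Fin n → Fin n → ℕ) → ∑₃ (λ i j k → f k i j) ≡ ∑₃ f
  ∑₃-rotate f = trans (∑-cong (allFin n) λ i → ∑-comm (allFin n) (allFin n) λ j k → f k i j)
                      (∑-comm (allFin n) (allFin n) λ i k → ∑ (allFin n) (f k i))

  ∑₃-reverse : (f : Fin n → Fin n → Fin n → ℕ) → ∑₃ (λ i j k → f k j i) ≡ ∑₃ f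
  ∑₃-reverse f = begin
    ∑₃ (λ i j k → f k j i)                   ≡⟨ ∑-comm V V (λ i j → ∑ V λ k → f k j i) ⟩
    ∑ V (λ j → ∑ V λ i → ∑ V λ k → f k j i)  ≡⟨ ∑-cong V (λ j → ∑-comm V V λ i k → f k j i) ⟩
    ∑ V (λ j → ∑ V λ k → ∑ V λ i → f k j i)  ≡⟨ ∑-comm V V (λ j k → ∑ V (f k j)) ⟩
    ∑₃ f                                     ∎
    where
    open ≡-Reasoning
    V : List (Fin n)
    V = allFin n

  ⟦⟧-split : (P : Fin n → Fin n → Bool) → (∀ i j → P i j ≡ P j i) → (∀ i → P i i ≡ false) →
    ∀ i j → ⟦ P i j ⟧ ≡ ⟦ (toℕ i <ᵇ toℕ j) ∧ P i j ⟧ + ⟦ (toℕ j <ᵇ toℕ i) ∧ P j i ⟧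
  ⟦⟧-split P sym-P irrefl-P i j with <-cmp (toℕ i) (toℕ j)
  ... | tri< i<j _ _ rewrite <ᵇ-true i<j | <ᵇ-false (<⇒≤ i<j) = sym (+-identityʳ _)
  ... | tri> _ _ j<i rewrite <ᵇ-true j<i | <ᵇ-false (<⇒≤ j<i) | sym-P i j = refl
  ... | tri≈ _ i≡j _ rewrite toℕ-injective i≡j | irrefl-P j | ∧-zeroʳ (toℕ j <ᵇ toℕ j) = refl

  countPairs-double : (P : Fin n → Fin n → Bool) → (∀ i j → P i j ≡ P j i) → (∀ i → P i i ≡ false) →
    2 * countPairs P ≡ ∑₂ (λ i j → ⟦ P i j ⟧)
  countPairs-double P sym-P irrefl-P = sym (begin
    ∑₂ (λ i j → ⟦ P i j ⟧)                                ≡⟨ ∑₂-cong (⟦⟧-split P sym-P irrefl-P) ⟩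
    ∑₂ (λ i j → ⟦ lt i j ∧ P i j ⟧ + ⟦ lt j i ∧ P j i ⟧)  ≡⟨ ∑₂-+ _ _ ⟩
    countPairs P + ∑₂ (λ i j → ⟦ lt j i ∧ P j i ⟧)       ≡⟨ cong (countPairs P +_) (∑₂-flip (λ i j → ⟦ lt i j ∧ P i j ⟧)) ⟩
    countPairs P + countPairs P                           ≡⟨ cong (countPairs P +_) (+-identityʳ _) ⟨
    2 * countPairs P                                      ∎)
    where
    open ≡-Reasoning
    lt : Fin n → Fin n → Bool
    lt i j = toℕ i <ᵇ toℕ j

  countPairs-∨ : (P Q : Fin n → Fin n → Bool) → countPairs (λ i j → P i j ∨ Q i j) ≤ countPairs P + countPairs Q
  countPairs-∨ P Q =
    ≤-trans (∑₂-mono λ i j → ⟦∧∨⟧-≤ (toℕ i <ᵇ toℕ j) (P i j) (Q i j)) (≤-reflexive (∑₂-+ _ _))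
    where
    ⟦∧∨⟧-≤ : ∀ l a b → ⟦ l ∧ (a ∨ b) ⟧ ≤ ⟦ l ∧ a ⟧ + ⟦ l ∧ b ⟧
    ⟦∧∨⟧-≤ false a     b = z≤n
    ⟦∧∨⟧-≤ true  true  b = s≤s z≤n
    ⟦∧∨⟧-≤ true  false b = ≤-refl

  countPairs-∨-disjoint : (P Q : Fin n → Fin n → Bool) → (∀ i j → P i j ≡ true → Q i j ≡ false) →
    countPairs P + countPairs Q ≤ countPairs (λ i j → P i j ∨ Q i j)
  countPairs-∨-disjoint P Q disjoint =
    ≤-trans (≤-reflexive (sym (∑₂-+ _ _)))
            (∑₂-mono λ i j → ⟦∧∨⟧-≥ (toℕ i <ᵇ toℕ j) (P i j) (Q i j) (disjoint i j))
    where
    ⟦∧∨⟧-≥ : ∀ l a b → (a ≡ true → b ≡ false) → ⟦ l ∧ a ⟧ + ⟦ l ∧ b ⟧ ≤ ⟦ l ∧ (a ∨ b) ⟧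
    ⟦∧∨⟧-≥ false a     b _  = z≤n
    ⟦∧∨⟧-≥ true  true  b ¬b rewrite ¬b refl = ≤-refl
    ⟦∧∨⟧-≥ true  false b _  = ≤-refl

  ∑-⟦∧⟧-∑₂ : (xs : List A) (b : Fin n → Fin n → Bool) (e : A → Fin n → Fin n → Bool) →
    ∑ xs (λ x → ∑₂ (λ i j → ⟦ b i j ∧ e x i j ⟧)) ≡ ∑₂ (λ i j → ⟦ b i j ⟧ * ∑ xs (λ x → ⟦ e x i j ⟧))
  ∑-⟦∧⟧-∑₂ xs b e =
    trans (∑-comm xs (allFin n) _) (∑-cong (allFin n) λ i → ∑-⟦∧⟧ xs (allFin n) (b i) (λ x → e x i))

  ∑-⟦∧⟧-∑₃ : (xs : List A) (b : Fin n → Fin n → Fin n → Bool) (e : A → Fin n → Fin n → Fin n → Bool) →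
    ∑ xs (λ x → ∑₃ (λ i j k → ⟦ b i j k ∧ e x i j k ⟧)) ≡
    ∑₃ (λ i j k → ⟦ b i j k ⟧ * ∑ xs (λ x → ⟦ e x i j k ⟧))
  ∑-⟦∧⟧-∑₃ xs b e =
    trans (∑-comm xs (allFin n) _) (∑-cong (allFin n) λ i → ∑-⟦∧⟧-∑₂ xs (b i) (λ x → e x i))

true≢false : true ≢ false
true≢false ()

∧-≡true : ∀ {a b} → a ∧ b ≡ true → a ≡ true × b ≡ true
∧-≡true {true} {true} _ = refl , refl

∨-≡true : ∀ {a b} → a ∨ b ≡ true → a ≡ true ⊎ b ≡ true
∨-≡true {true}  _ = inj₁ refl
∨-≡true {false} h = inj₂ h

∨-≡false : ∀ {a b} → a ∨ b ≡ false → a ≡ false × b ≡ false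
∨-≡false {false} {false} _ = refl , refl

exactlyTwo : Bool → Bool → Bool → Bool
exactlyTwo x y z = (x ∧ y ∧ not z) ∨ (x ∧ not y ∧ z) ∨ (not x ∧ y ∧ z)

exactlyTwo-swap₁₂ : ∀ x y z → exactlyTwo x y z ≡ exactlyTwo y x z
exactlyTwo-swap₁₂ true  true  true  = refl
exactlyTwo-swap₁₂ true  true  false = refl
exactlyTwo-swap₁₂ true  false true  = refl
exactlyTwo-swap₁₂ true  false false = refl
exactlyTwo-swap₁₂ false true  true  = refl
exactlyTwo-swap₁₂ false true  false = refl
exactlyTwo-swap₁₂ false false true  = refl
exactlyTwo-swap₁₂ false false false = refl

exactlyTwo-swap₂₃ : ∀ x y z → exactlyTwo x y z ≡ exactlyTwo x z y
exactlyTwo-swap₂₃ true  true  true  = refl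
exactlyTwo-swap₂₃ true  true  false = refl
exactlyTwo-swap₂₃ true  false true  = refl
exactlyTwo-swap₂₃ true  false false = refl
exactlyTwo-swap₂₃ false true  true  = refl
exactlyTwo-swap₂₃ false true  false = refl
exactlyTwo-swap₂₃ false false true  = refl
exactlyTwo-swap₂₃ false false false = refl

∨-diagonal : ∀ x y → x ∨ x ∨ y ≡ x ∨ y ∨ y
∨-diagonal true  y = refl
∨-diagonal false y = sym (∨-idem y)

∧-diagonal : ∀ x y → x ∧ x ∧ y ≡ x ∧ y ∧ y
∧-diagonal true  y = sym (∧-idem y)
∧-diagonal false y = refl

Bool-cases : (b : Bool) → b ≡ true ⊎ b ≡ false
Bool-cases true  = inj₁ refl
Bool-cases false = inj₂ refl

≡true-≡false-≢ : {A : Set} (p : A → Bool) {a b : A} → p a ≡ true → p b ≡ false → a ≢ b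
≡true-≡false-≢ p pa pb refl = true≢false (trans (sym pa) pb)

module _ {n : ℕ} where

  ==-refl : (x : Fin n) → (x == x) ≡ true
  ==-refl x with x ≟ x
  ... | yes _  = refl
  ... | no x≢x = ⊥-elim (x≢x refl)

  ==⇒≡ : {x y : Fin n} → (x == y) ≡ true → x ≡ y
  ==⇒≡ {x} {y} eq with x ≟ y
  ... | yes x≡y = x≡y

  ≢⇒==false : {x y : Fin n} → x ≢ y → (x == y) ≡ false
  ≢⇒==false {x} {y} x≢y with x ≟ y
  ... | yes x≡y = ⊥-elim (x≢y x≡y)
  ... | no _    = refl

  ==false⇒≢ : {x y : Fin n} → (x == y) ≡ false → x ≢ y
  ==false⇒≢ {x} eq refl = true≢false (trans (sym (==-refl x)) eq)

  ==-sym : (x y : Fin n) → (x == y) ≡ (y == x)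
  ==-sym x y with x ≟ y | y ≟ x
  ... | yes _   | yes _   = refl
  ... | no _    | no _    = refl
  ... | yes x≡y | no y≢x  = ⊥-elim (y≢x (sym x≡y))
  ... | no x≢y  | yes y≡x = ⊥-elim (x≢y (sym y≡x))

  transpose-matchˡ : (a b : Fin n) → transpose a b a ≡ b
  transpose-matchˡ a b rewrite dec-true (a ≟ a) refl = refl

  transpose-matchʳ : (a b : Fin n) → transpose a b b ≡ a
  transpose-matchʳ a b with b ≟ a
  ... | yes refl = refl
  ... | no b≢a rewrite dec-true (b ≟ b) refl = refl

  transpose-other : (a b x : Fin n) → x ≢ a → x ≢ b → transpose a b x ≡ x
  transpose-other a b x x≢a x≢b rewrite dec-false (x ≟ a) x≢a | dec-false (x ≟ b) x≢b = refl

  Complete : List (Fin n) → Set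
  Complete π = ∀ x → x ∈ π

  ↭⇒complete : ∀ {π} → π ↭ allFin n → Complete π
  ↭⇒complete π↭ x = ∈-resp-↭ (↭-sym π↭) (∈-allFin x)

  everyone : VSet n
  everyone _ = true

  _is_ : Maybe (Fin n) → Fin n → Bool
  nothing is a = false
  just v  is a = v == a

  is⇒≡just : ∀ m a → m is a ≡ true → m ≡ just a
  is⇒≡just (just v) a h = cong just (==⇒≡ h)

  ∧-is : ∀ {b m a} → b ≡ true → m ≡ just a → b ∧ (m is a) ≡ true
  ∧-is {a = a} refl refl = ==-refl a

∈-tail : {A : Set} {x y : A} {xs : List A} → x ∈ y ∷ xs → y ≢ x → x ∈ xs
∈-tail (here refl) y≢x = ⊥-elim (y≢x refl)
∈-tail (there x∈xs) _  = x∈xs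

exactlyTwo-cases : ∀ x y z → exactlyTwo x y z ≡ true →
  (x ≡ true × y ≡ true × z ≡ false) ⊎
  (x ≡ true × y ≡ false × z ≡ true) ⊎
  (x ≡ false × y ≡ true × z ≡ true)
exactlyTwo-cases true  true  false _ = inj₁ (refl , refl , refl)
exactlyTwo-cases true  false true  _ = inj₂ (inj₁ (refl , refl , refl))
exactlyTwo-cases false true  true  _ = inj₂ (inj₂ (refl , refl , refl))
exactlyTwo-cases true  true  true  ()
exactlyTwo-cases true  false false ()
exactlyTwo-cases false true  false ()
exactlyTwo-cases false false true  ()
exactlyTwo-cases false false false ()

≤-charge₂ : ∀ X p q → p ≡ true ⊎ q ≡ true → X ≤ ⟦ p ⟧ * X + ⟦ q ⟧ * X
≤-charge₂ X p q (inj₁ refl) = ≤-trans (≤-reflexive (sym (*-identityˡ X))) (m≤m+n (1 * X) (⟦ q ⟧ * X))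
≤-charge₂ X p q (inj₂ refl) = ≤-trans (≤-reflexive (sym (*-identityˡ X))) (m≤n+m (1 * X) (⟦ p ⟧ * X))

≤-charge₃ : ∀ X p q r → p ≡ true ⊎ q ≡ true ⊎ r ≡ true → X ≤ ⟦ p ⟧ * X + (⟦ q ⟧ * X + ⟦ r ⟧ * X)
≤-charge₃ X p q r (inj₁ p≡t) =
  ≤-trans (≤-charge₂ X p q (inj₁ p≡t)) (+-monoʳ-≤ (⟦ p ⟧ * X) (m≤m+n (⟦ q ⟧ * X) (⟦ r ⟧ * X)))
≤-charge₃ X p q r (inj₂ q∨r) =
  ≤-trans (≤-charge₂ X q r q∨r) (m≤n+m (⟦ q ⟧ * X + ⟦ r ⟧ * X) (⟦ p ⟧ * X))

-- The pivot process

module _ {n : ℕ} (G : Graph n) where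

  N[_] : Fin n → VSet n
  N[ v ] x = (x == v) ∨ adj G v x

  N-self : ∀ v → N[ v ] v ≡ true
  N-self v rewrite ==-refl v = refl

  N-adj : ∀ {v x} → adj G v x ≡ true → N[ v ] x ≡ true
  N-adj {v} {x} vx rewrite vx = ∨-zeroʳ (x == v)

  N-≢ : ∀ {v x} → N[ v ] x ≡ true → v ≢ x → adj G v x ≡ true
  N-≢ {v} {x} vx v≢x rewrite ≢⇒==false (λ x≡v → v≢x (sym x≡v)) = vx

  N-false-≢ : ∀ {v x} → N[ v ] x ≡ false → v ≢ x
  N-false-≢ {v} vx = ≡true-≡false-≢ N[ v ] (N-self v) vx

  N-absent : ∀ {v x} → N[ v ] x ≡ false → adj G v x ≡ false
  N-absent vx = proj₂ (∨-≡false vx)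

  N-non-adjacent : ∀ {v x} → N[ v ] x ≡ true → adj G v x ≡ false → x ≡ v
  N-non-adjacent {v} {x} vx ¬vx rewrite ¬vx = ==⇒≡ (trans (sym (∨-identityʳ (x == v))) vx)

  adj-≢ : ∀ {x y} → adj G x y ≡ true → x ≢ y
  adj-≢ {x} xy refl = true≢false (trans (sym xy) (irrefl G x))

  adjacent⇒≡⇒nonadjacent : ∀ {x y} → (adj G x y ≡ true → x ≡ y) → adj G x y ≡ false
  adjacent⇒≡⇒nonadjacent {x} {y} h with adj G x y in xy
  ... | false = refl
  ... | true  = ⊥-elim (adj-≢ xy (h refl))

  dropNbhd : VSet n → Fin n → VSet n
  dropNbhd U v = if U v then (λ x → U x ∧ not (N[ v ] x)) else U

  dropNbhd-⊆ : ∀ U v x → dropNbhd U v x ≡ true → U x ≡ true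
  dropNbhd-⊆ U v x h with U v
  ... | true  = proj₁ (∧-≡true h)
  ... | false = h

  dropNbhd-N : ∀ U v x → U v ≡ true → N[ v ] x ≡ true → dropNbhd U v x ≡ false
  dropNbhd-N U v x uv vx rewrite uv | vx = ∧-zeroʳ (U x)

  dropNbhd-self : ∀ U v → dropNbhd U v v ≡ false
  dropNbhd-self U v with U v in uv
  ... | true  rewrite ==-refl v = ∧-zeroʳ (U v)
  ... | false = uv

  dropNbhd-unavailable : ∀ U v x → U x ≡ false → dropNbhd U v x ≡ false
  dropNbhd-unavailable U v x ux with U v
  ... | true  rewrite ux = refl
  ... | false = ux

  dropNbhd-keeps : ∀ U v x → U v ≡ true → N[ v ] x ≡ false → dropNbhd U v x ≡ U x
  dropNbhd-keeps U v x uv vx rewrite uv | vx = ∧-identityʳ (U x)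

  open PivotState using () renaming (U to available; lab to label)

  run : PivotState n → List (Fin n) → PivotState n
  run = foldl (pivotStep G)

  initial : PivotState n
  initial = piv (λ _ → true) (λ x → x)

  step-available : ∀ s v → available (pivotStep G s v) ≡ dropNbhd (available s) v
  step-available (piv U lab) v with U v
  ... | true  = refl
  ... | false = refl

  step-skips : ∀ s v → available s v ≡ false → pivotStep G s v ≡ s
  step-skips (piv U lab) v uv rewrite uv = refl

  step-keeps : ∀ s v x → available s v ≡ true → available s x ≡ true → N[ v ] x ≡ false →
    available (pivotStep G s v) x ≡ true
  step-keeps s v x uv ux vx =
    trans (cong-app (step-available s v) x) (trans (dropNbhd-keeps (available s) v x uv vx) ux)

  step-stays-unavailable : ∀ s v x → available s x ≡ false → available (pivotStep G s v) x ≡ false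
  step-stays-unavailable s v x ux = trans (cong-app (step-available s v) x) (dropNbhd-unavailable (available s) v x ux)

  step-label-N : ∀ s v x → available s v ≡ true → available s x ≡ true → N[ v ] x ≡ true →
    label (pivotStep G s v) x ≡ v
  step-label-N (piv U lab) v x uv ux vx rewrite uv | ux | vx = refl

  step-label-unavailable : ∀ s v x → available s x ≡ false → label (pivotStep G s v) x ≡ label s x
  step-label-unavailable (piv U lab) v x ux with U v
  ... | true  rewrite ux = refl
  ... | false = refl

  run-frozen : ∀ s π x → available s x ≡ false → label (run s π) x ≡ label s x
  run-frozen s []      x ux = refl
  run-frozen s (v ∷ π) x ux =
    trans (run-frozen (pivotStep G s v) π x (step-stays-unavailable s v x ux)) (step-label-unavailable s v x ux)

  label-removed : ∀ s v x π → available s v ≡ true → available s x ≡ true → N[ v ] x ≡ true →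
    label (run (pivotStep G s v) π) x ≡ v
  label-removed s v x π uv ux vx = trans (run-frozen (pivotStep G s v) π x removed) (step-label-N s v x uv ux vx)
    where
    removed : available (pivotStep G s v) x ≡ false
    removed = trans (cong-app (step-available s v) x) (dropNbhd-N (available s) v x uv vx)

  run-unavailable : ∀ s π x → available s x ≡ false → available (run s π) x ≡ false
  run-unavailable s []      x ux = ux
  run-unavailable s (v ∷ π) x ux = run-unavailable (pivotStep G s v) π x (step-stays-unavailable s v x ux)

  run-∈-unavailable : ∀ s π x → x ∈ π → available (run s π) x ≡ false
  run-∈-unavailable s (v ∷ π) x (here refl) = run-unavailable (pivotStep G s x) π x
    (trans (cong-app (step-available s x) x) (dropNbhd-self (available s) x))
  run-∈-unavailable s (v ∷ π) x (there x∈π) = run-∈-unavailable (pivotStep G s v) π x x∈π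

  inTriple : Fin n → Fin n → Fin n → VSet n
  inTriple a b c v = (v == a) ∨ (v == b) ∨ (v == c)

  inTriple-₁ : ∀ a b c → inTriple a b c a ≡ true
  inTriple-₁ a b c rewrite ==-refl a = refl

  inTriple-₂ : ∀ a b c → inTriple a b c b ≡ true
  inTriple-₂ a b c rewrite ==-refl b = ∨-zeroʳ (b == a)

  inTriple-≢ : ∀ {a b c v} → v ≢ a → v ≢ b → v ≢ c → inTriple a b c v ≡ false
  inTriple-≢ v≢a v≢b v≢c rewrite ≢⇒==false v≢a | ≢⇒==false v≢b | ≢⇒==false v≢c = refl

  available₃ : VSet n → Fin n → Fin n → Fin n → Bool
  available₃ U a b c = U a ∧ U b ∧ U c

  available₃-⊆ : ∀ U v a b c → available₃ (dropNbhd U v) a b c ≡ true → available₃ U a b c ≡ true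
  available₃-⊆ U v a b c h with ua , h′ ← ∧-≡true h with ub , uc ← ∧-≡true h′
    rewrite dropNbhd-⊆ U v a ua | dropNbhd-⊆ U v b ub | dropNbhd-⊆ U v c uc = refl

  triplePivot : VSet n → Fin n → Fin n → Fin n → List (Fin n) → Maybe (Fin n)
  triplePivot U a b c []      = nothing
  triplePivot U a b c (v ∷ π) =
    if inTriple a b c v then (if available₃ U a b c then just v else nothing)
    else triplePivot (dropNbhd U v) a b c π

  triplePivot-head : ∀ U a b c v π → inTriple a b c v ≡ true → available₃ U a b c ≡ true →
    triplePivot U a b c (v ∷ π) ≡ just v
  triplePivot-head U a b c v π hit avail rewrite hit | avail = refl

  triplePivot-skip : ∀ U a b c v π → inTriple a b c v ≡ false →
    triplePivot U a b c (v ∷ π) ≡ triplePivot (dropNbhd U v) a b c π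
  triplePivot-skip U a b c v π miss rewrite miss = refl

  triplePivot-available : ∀ U a b c π {w} → triplePivot U a b c π ≡ just w → available₃ U a b c ≡ true
  triplePivot-available U a b c (v ∷ π) h with inTriple a b c v
  ... | false = available₃-⊆ U v a b c (triplePivot-available (dropNbhd U v) a b c π h)
  ... | true with available₃ U a b c
  ...   | true = refl

  label-covers : ∀ s π x → x ∈ π → available s x ≡ true → N[ label (run s π) x ] x ≡ true
  label-covers s (v ∷ π) x x∈ ux with Bool-cases (available s v)
  ... | inj₂ uv rewrite step-skips s v uv =
    label-covers s π x (∈-tail x∈ (≡true-≡false-≢ (available s) ux uv ∘ sym)) ux
  ... | inj₁ uv with N[ v ] x in vx
  ...   | true  rewrite label-removed s v x π uv ux vx = vx
  ...   | false = label-covers (pivotStep G s v) π x (∈-tail x∈ (N-false-≢ vx)) (step-keeps s v x uv ux vx)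

  label-idempotent : ∀ s π x → x ∈ π → available s x ≡ true →
    label (run s π) (label (run s π) x) ≡ label (run s π) x
  label-idempotent s (v ∷ π) x x∈ ux with Bool-cases (available s v)
  ... | inj₂ uv rewrite step-skips s v uv =
    label-idempotent s π x (∈-tail x∈ (≡true-≡false-≢ (available s) ux uv ∘ sym)) ux
  ... | inj₁ uv with N[ v ] x in vx
  ...   | true  rewrite label-removed s v x π uv ux vx = label-removed s v v π uv uv (N-self v)
  ...   | false = label-idempotent (pivotStep G s v) π x (∈-tail x∈ (N-false-≢ vx)) (step-keeps s v x uv ux vx)

  -- The cluster of x is opened before y is clustered.
  ClusteredFirst : PivotState n → List (Fin n) → Fin n → Fin n → Set
  ClusteredFirst s π x y =
    triplePivot (available s) (L x) x y π ≡ just (L x) × (N[ L x ] y ≡ true → L y ≡ L x)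
    where
    L : Fin n → Fin n
    L = label (run s π)

  clusteredFirst-head : ∀ s u π x y → available s u ≡ true → available s x ≡ true → available s y ≡ true →
    N[ u ] x ≡ true → ClusteredFirst s (u ∷ π) x y
  clusteredFirst-head s u π x y uu ux uy ux∈N rewrite label-removed s u x π uu ux ux∈N =
    triplePivot-head (available s) u x y u π (inTriple-₁ u x y) (cong₂ _∧_ uu (cong₂ _∧_ ux uy)) ,
    label-removed s u y π uu uy

  clusteredFirst-∷ : ∀ s u π x y → u ≢ x → u ≢ y →
    ClusteredFirst (pivotStep G s u) π x y ⊎ ClusteredFirst (pivotStep G s u) π y x →
    ClusteredFirst s (u ∷ π) x y ⊎ ClusteredFirst s (u ∷ π) y x
  clusteredFirst-∷ s u π x y u≢x u≢y = Sum.map (lift x y u≢x u≢y) (lift y x u≢y u≢x)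
    where
    lift : ∀ x y → u ≢ x → u ≢ y → ClusteredFirst (pivotStep G s u) π x y → ClusteredFirst s (u ∷ π) x y
    lift x y u≢x u≢y (first , covers) = trans skip first , covers
      where
      v : Fin n
      v = label (run (pivotStep G s u) π) x
      u≢v : u ≢ v
      u≢v = ≡true-≡false-≢ (available (pivotStep G s u))
              (proj₁ (∧-≡true (triplePivot-available _ v x y π first)))
              (trans (cong-app (step-available s u) u) (dropNbhd-self (available s) u)) ∘ sym
      skip : triplePivot (available s) v x y (u ∷ π) ≡ triplePivot (available (pivotStep G s u)) v x y π
      skip = trans (triplePivot-skip (available s) v x y u π (inTriple-≢ u≢v u≢x u≢y))
                   (cong (λ U → triplePivot U v x y π) (sym (step-available s u)))

  clusteredFirst : ∀ s π x y → x ∈ π → y ∈ π → available s x ≡ true → available s y ≡ true →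
    ClusteredFirst s π x y ⊎ ClusteredFirst s π y x
  clusteredFirst s (u ∷ π) x y x∈ y∈ ux uy with Bool-cases (available s u)
  ... | inj₂ uu = clusteredFirst-∷ s u π x y u≢x u≢y
    (clusteredFirst (pivotStep G s u) π x y (∈-tail x∈ u≢x) (∈-tail y∈ u≢y)
      (trans (cong (λ t → available t x) (step-skips s u uu)) ux)
      (trans (cong (λ t → available t y) (step-skips s u uu)) uy))
    where
    u≢x : u ≢ x
    u≢x = ≡true-≡false-≢ (available s) ux uu ∘ sym
    u≢y : u ≢ y
    u≢y = ≡true-≡false-≢ (available s) uy uu ∘ sym
  ... | inj₁ uu with N[ u ] x in ux∈N | N[ u ] y in uy∈N
  ...   | true  | _     = inj₁ (clusteredFirst-head s u π x y uu ux uy ux∈N)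
  ...   | false | true  = inj₂ (clusteredFirst-head s u π y x uu uy ux uy∈N)
  ...   | false | false = clusteredFirst-∷ s u π x y (N-false-≢ ux∈N) (N-false-≢ uy∈N)
    (clusteredFirst (pivotStep G s u) π x y (∈-tail x∈ (N-false-≢ ux∈N)) (∈-tail y∈ (N-false-≢ uy∈N))
      (step-keeps s u x uu ux ux∈N) (step-keeps s u y uu uy uy∈N))

  -- GreedyMIS is the pivot process without labels: its chosen vertices are the removed self-labelled ones.
  Simulates : MISState n → PivotState n → Set
  Simulates m s = (∀ x → MISState.U m x ≡ available s x)
                × (∀ x → MISState.I m x ≡ not (available s x) ∧ (label s x == x))

  simulates-step : ∀ m s v → Simulates m s → Simulates (greedyStep G m v) (pivotStep G s v)
  simulates-step (mis U I) (piv U′ lab) v (U≡ , I≡) with U v in uv | U′ v in uv′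
  ... | false | false = U≡ , I≡
  ... | true  | false = ⊥-elim (true≢false (trans (sym uv) (trans (U≡ v) uv′)))
  ... | false | true  = ⊥-elim (true≢false (trans (sym uv′) (trans (sym (U≡ v)) uv)))
  ... | true  | true  = (λ x → cong (_∧ not (N[ v ] x)) (U≡ x)) , I≡′
    where
    I≡′ : ∀ x → (x == v) ∨ I x ≡ not (U′ x ∧ not (N[ v ] x)) ∧ ((if U′ x ∧ N[ v ] x then v else lab x) == x)
    I≡′ x rewrite I≡ x with U′ x in ux | x == v in xv
    ... | false | false = refl
    ... | false | true  = ⊥-elim (≡true-≡false-≢ U′ uv′ ux (sym (==⇒≡ xv)))
    ... | true  | true  rewrite ==⇒≡ xv = sym (==-refl v)
    ... | true  | false with adj G v x
    ...   | false = refl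
    ...   | true  = trans (sym xv) (==-sym x v)

  simulates-run : ∀ m s π → Simulates m s → Simulates (foldl (greedyStep G) m π) (run s π)
  simulates-run m s []      sim = sim
  simulates-run m s (v ∷ π) sim = simulates-run (greedyStep G m v) (pivotStep G s v) π (simulates-step m s v sim)

  greedyMIS≡pivots : ∀ π x → x ∈ π → greedyMIS G π x ≡ (pivotClustering G π x == x)
  greedyMIS≡pivots π x x∈π rewrite proj₂ (simulates-run _ initial π ((λ _ → refl) , (λ _ → refl))) x
                                 | run-∈-unavailable initial π x x∈π = refl

  openWedge : Fin n → Fin n → Fin n → Bool
  openWedge a b c = not (a == b) ∧ not (a == c) ∧ not (b == c) ∧ exactlyTwo (adj G a b) (adj G a c) (adj G b c)

  openWedge-swap₁₂ : ∀ a b c → openWedge a b c ≡ openWedge b a c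
  openWedge-swap₁₂ a b c rewrite ==-sym b a | Graph.sym G b a with a == b | a == c | b == c
  ... | true  | _     | _     = refl
  ... | false | true  | true  = refl
  ... | false | true  | false = refl
  ... | false | false | true  = refl
  ... | false | false | false = exactlyTwo-swap₂₃ (adj G a b) (adj G a c) (adj G b c)

  openWedge-swap₂₃ : ∀ a b c → openWedge a b c ≡ openWedge a c b
  openWedge-swap₂₃ a b c rewrite ==-sym c b | Graph.sym G c b with a == b | a == c | b == c
  ... | true  | true  | _     = refl
  ... | true  | false | _     = refl
  ... | false | true  | _     = refl
  ... | false | false | true  = refl
  ... | false | false | false = exactlyTwo-swap₁₂ (adj G a b) (adj G a c) (adj G b c)

  openWedge-intro : ∀ {a b c} → a ≢ b → a ≢ c → b ≢ c → exactlyTwo (adj G a b) (adj G a c) (adj G b c) ≡ true →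
    openWedge a b c ≡ true
  openWedge-intro a≢b a≢c b≢c two rewrite ≢⇒==false a≢b | ≢⇒==false a≢c | ≢⇒==false b≢c = two

  openWedge-elim : ∀ {a b c} → openWedge a b c ≡ true →
    a ≢ b × a ≢ c × b ≢ c × exactlyTwo (adj G a b) (adj G a c) (adj G b c) ≡ true
  openWedge-elim h with ab , h₁ ← ∧-≡true h with ac , h₂ ← ∧-≡true h₁ with bc , two ← ∧-≡true h₂ =
    ==false⇒≢ (not-injective ab) , ==false⇒≢ (not-injective ac) , ==false⇒≢ (not-injective bc) , two

  openWedge-adjacent : ∀ {v i j} → openWedge v i j ≡ true → (adj G v i ∨ adj G v j) ≡ true
  openWedge-adjacent {v} {i} {j} h
    with exactlyTwo-cases (adj G v i) (adj G v j) (adj G i j) (proj₂ (proj₂ (proj₂ (openWedge-elim h))))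
  ... | inj₁ (vi , _ , _)          rewrite vi = refl
  ... | inj₂ (inj₁ (vi , _ , _))   rewrite vi = refl
  ... | inj₂ (inj₂ (_ , vj , _))   rewrite vj = ∨-zeroʳ (adj G v i)

  Mistake : (Fin n → Fin n) → Fin n → Fin n → Bool
  Mistake c i j = inducedW G c i j ∨ inducedN G c i j

  Mistake-sym : ∀ c i j → Mistake c i j ≡ Mistake c j i
  Mistake-sym c i j rewrite Graph.sym G i j | ==-sym (c i) (c j) | ==-sym i j = refl

  Mistake-irrefl : ∀ c i → Mistake c i i ≡ false
  Mistake-irrefl c i rewrite irrefl G i | ==-refl i = ∧-zeroʳ _

  mistake-together : ∀ c i j → Mistake c i j ≡ true → c i ≡ c j → adj G i j ≡ false × i ≢ j
  mistake-together c i j m ci≡cj rewrite ci≡cj | ==-refl (c j) with adj G i j | i == j in i=j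
  ... | false | false = refl , ==false⇒≢ i=j

  mistake-apart : ∀ c i j → Mistake c i j ≡ true → c i ≢ c j → adj G i j ≡ true
  mistake-apart c i j m ci≢cj rewrite ≢⇒==false ci≢cj with adj G i j
  ... | true = refl

  mistake⇒openWedge : ∀ c v i j → c i ≡ v → N[ v ] i ≡ true → N[ c j ] j ≡ true →
    (N[ v ] j ≡ true → c j ≡ v) → Mistake c i j ≡ true → openWedge v i j ≡ true
  mistake⇒openWedge c v i j ci≡v vi cj-j covers m with N[ v ] j in vj
  ... | true  = openWedge-intro v≢i v≢j i≢j two
    where
    together : adj G i j ≡ false × i ≢ j
    together = mistake-together c i j m (trans ci≡v (sym (covers refl)))
    i≢j : i ≢ j
    i≢j = proj₂ together
    v≢i : v ≢ i
    v≢i refl = i≢j (sym (N-non-adjacent vj (proj₁ together)))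
    v≢j : v ≢ j
    v≢j refl = i≢j (N-non-adjacent vi (trans (Graph.sym G v i) (proj₁ together)))
    two : exactlyTwo (adj G v i) (adj G v j) (adj G i j) ≡ true
    two rewrite N-≢ vi v≢i | N-≢ vj v≢j | proj₁ together = refl
  ... | false = openWedge-intro v≢i v≢j (adj-≢ ij) two
    where
    ij : adj G i j ≡ true
    ij = mistake-apart c i j m λ ci≡cj →
      true≢false (trans (sym cj-j) (trans (cong (λ w → N[ w ] j) (trans (sym ci≡cj) ci≡v)) vj))
    v≢i : v ≢ i
    v≢i refl = true≢false (trans (sym (N-adj ij)) vj)
    v≢j = N-false-≢ vj
    two : exactlyTwo (adj G v i) (adj G v j) (adj G i j) ≡ true
    two rewrite N-≢ vi v≢i | N-absent vj | ij = refl

  triplePivot-cong : ∀ U a b c a′ b′ c′ π →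
    (∀ v → inTriple a b c v ≡ inTriple a′ b′ c′ v) → (∀ U → available₃ U a b c ≡ available₃ U a′ b′ c′) →
    triplePivot U a b c π ≡ triplePivot U a′ b′ c′ π
  triplePivot-cong U a b c a′ b′ c′ []      sameT sameA = refl
  triplePivot-cong U a b c a′ b′ c′ (v ∷ π) sameT sameA
    rewrite sameT v | sameA U | triplePivot-cong (dropNbhd U v) a b c a′ b′ c′ π sameT sameA = refl

  triplePivot-swap₂₃ : ∀ U a b c π → triplePivot U a b c π ≡ triplePivot U a c b π
  triplePivot-swap₂₃ U a b c π = triplePivot-cong U a b c a c b π
    (λ v → cong ((v == a) ∨_) (∨-comm (v == b) (v == c))) (λ U → cong (U a ∧_) (∧-comm (U b) (U c)))

  triplePivot-diagonal : ∀ U a b π → triplePivot U a a b π ≡ triplePivot U a b b π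
  triplePivot-diagonal U a b π = triplePivot-cong U a a b a b b π
    (λ v → ∨-diagonal (v == a) (v == b)) (λ U → ∧-diagonal (U a) (U b))

  module _ {π : List (Fin n)} (complete : Complete π) where

    private
      L : Fin n → Fin n
      L = pivotClustering G π

    pivot-covers : ∀ x → N[ L x ] x ≡ true
    pivot-covers x = label-covers initial π x (complete x) refl

    pivot-idempotent : ∀ x → L (L x) ≡ L x
    pivot-idempotent x = label-idempotent initial π x (complete x) refl

    pivot-first : ∀ x y → ClusteredFirst initial π x y ⊎ ClusteredFirst initial π y x
    pivot-first x y = clusteredFirst initial π x y (complete x) (complete y) refl refl

    pivots-independent : ∀ x y → L x ≡ x → L y ≡ y → adj G x y ≡ false
    pivots-independent x y Lx Ly =
      adjacent⇒≡⇒nonadjacent λ xy → Sum.[ first x y Lx Ly xy , sym ∘ first y x Ly Lx (trans (Graph.sym G y x) xy) ] (pivot-first x y)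
      where
      first : ∀ x y → L x ≡ x → L y ≡ y → adj G x y ≡ true → ClusteredFirst initial π x y → x ≡ y
      first x y Lx Ly xy (_ , covers) =
        sym (trans (sym Ly) (trans (covers (subst (λ v → N[ v ] y ≡ true) (sym Lx) (N-adj xy))) Lx))

    ∈MIS⇒pivot : ∀ x → greedyMIS G π x ≡ true → L x ≡ x
    ∈MIS⇒pivot x x∈I = ==⇒≡ (trans (sym (greedyMIS≡pivots π x (complete x))) x∈I)

    ∉MIS⇒non-pivot : ∀ x → greedyMIS G π x ≡ false → L x ≢ x
    ∉MIS⇒non-pivot x x∉I = ==false⇒≢ (trans (sym (greedyMIS≡pivots π x (complete x))) x∉I)

    greedyMIS-maximalIndependent : MaximalIndependent G (greedyMIS G π)
    greedyMIS-maximalIndependent = independent , maximal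
      where
      independent : Independent G (greedyMIS G π)
      independent x y x∈I y∈I = pivots-independent x y (∈MIS⇒pivot x x∈I) (∈MIS⇒pivot y y∈I)
      maximal : ∀ v → greedyMIS G π v ≡ false → ∃ λ u → greedyMIS G π u ≡ true × adj G u v ≡ true
      maximal v v∉I = L v , L-v∈I , N-≢ (pivot-covers v) (∉MIS⇒non-pivot v v∉I)
        where
        L-v∈I : greedyMIS G π (L v) ≡ true
        L-v∈I = trans (greedyMIS≡pivots π (L v) (complete (L v)))
                      (trans (cong (_== L v) (pivot-idempotent v)) (==-refl (L v)))

    ∉MIS⇒pivot-of-pair : ∀ x → greedyMIS G π x ≡ false →
      adj G (L x) x ≡ true × triplePivot everyone (L x) x x π ≡ just (L x)
    ∉MIS⇒pivot-of-pair x x∉I =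
      N-≢ (pivot-covers x) (∉MIS⇒non-pivot x x∉I) , Sum.[ proj₁ , proj₁ ]′ (pivot-first x x)

    mistake⇒wedge-pivot : ∀ i j → Mistake L i j ≡ true →
      ∃ λ v → openWedge v i j ≡ true × triplePivot everyone v i j π ≡ just v
    mistake⇒wedge-pivot i j m with pivot-first i j
    ... | inj₁ (first , covers) =
      L i , mistake⇒openWedge L (L i) i j refl (pivot-covers i) (pivot-covers j) covers m , first
    ... | inj₂ (first , covers) =
      L j ,
      trans (openWedge-swap₂₃ (L j) i j)
        (mistake⇒openWedge L (L j) j i refl (pivot-covers j) (pivot-covers i) covers (trans (Mistake-sym L j i) m)) ,
      trans (triplePivot-swap₂₃ everyone (L j) i j π) first

  independent⇒complement-cover : ∀ {S} → Independent G S → VertexCover G (complement S)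
  independent⇒complement-cover {S} indep i j ij with S i in i∈S | S j in j∈S
  ... | false | _     = inj₁ refl
  ... | true  | false = inj₂ refl
  ... | true  | true  = ⊥-elim (true≢false (trans (sym ij) (indep i j i∈S j∈S)))

  if-just : ∀ b {v w : Fin n} → (if b then just v else nothing) ≡ just w → b ≡ true × v ≡ w
  if-just true refl = refl , refl

  pivot-blocks : ∀ U c a b c′ → U c ≡ true → (adj G c a ∨ adj G c b) ≡ true →
    available₃ (dropNbhd U c) c′ a b ≡ false
  pivot-blocks U c a b c′ uc ca∨cb with ∨-≡true ca∨cb
  ... | inj₁ ca rewrite dropNbhd-N U c a uc (N-adj ca) = ∧-zeroʳ (dropNbhd U c c′)
  ... | inj₂ cb rewrite dropNbhd-N U c b uc (N-adj cb) | ∧-zeroʳ (dropNbhd U c a) = ∧-zeroʳ (dropNbhd U c c′)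

  triplePivot-blocked : ∀ U π a b c c′ → available₃ U c a b ≡ true → (adj G c a ∨ adj G c b) ≡ true →
    triplePivot (dropNbhd U c) c′ a b π ≢ just c′
  triplePivot-blocked U π a b c c′ avail c-ab h = true≢false (trans (sym (triplePivot-available _ c′ a b π h))
    (pivot-blocks U c a b c′ (proj₁ (∧-≡true avail)) c-ab))

  triplePivot-unique : ∀ U π a b c c′ → (adj G c a ∨ adj G c b) ≡ true → (adj G c′ a ∨ adj G c′ b) ≡ true →
    triplePivot U c a b π ≡ just c → triplePivot U c′ a b π ≡ just c′ → c ≡ c′
  triplePivot-unique U (v ∷ π) a b c c′ c-ab c′-ab h h′ with inTriple c a b v | inTriple c′ a b v
  ... | true  | true  = trans (sym (proj₂ (if-just _ h))) (proj₂ (if-just _ h′))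
  ... | true  | false with avail , refl ← if-just _ h  = ⊥-elim (triplePivot-blocked U π a b c c′ avail c-ab h′)
  ... | false | true  with avail , refl ← if-just _ h′ = ⊥-elim (triplePivot-blocked U π a b c′ c avail c′-ab h)
  ... | false | false = triplePivot-unique (dropNbhd U v) π a b c c′ c-ab c′-ab h h′

  triplePivot-map : ∀ (σ : Fin n → Fin n) a b c →
    (∀ v → inTriple a b c (σ v) ≡ inTriple a b c v) → (∀ v → inTriple a b c v ≡ false → σ v ≡ v) →
    ∀ U π → triplePivot U a b c (map σ π) ≡ Maybe.map σ (triplePivot U a b c π)
  triplePivot-map σ a b c σ-inTriple σ-fix U []      = refl
  triplePivot-map σ a b c σ-inTriple σ-fix U (v ∷ π) rewrite σ-inTriple v with inTriple a b c v in hit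
  ... | true with available₃ U a b c
  ...   | true  = refl
  ...   | false = refl
  triplePivot-map σ a b c σ-inTriple σ-fix U (v ∷ π) | false rewrite σ-fix v hit =
    triplePivot-map σ a b c σ-inTriple σ-fix (dropNbhd U v) π

  transpose-inTriple : ∀ a b c v → inTriple a b c (transpose a b v) ≡ inTriple a b c v
  transpose-inTriple a b c v with Bool-cases (v == a) | Bool-cases (v == b)
  ... | inj₁ va | _       rewrite ==⇒≡ va | transpose-matchˡ a b = trans (inTriple-₂ a b c) (sym (inTriple-₁ a b c))
  ... | inj₂ _  | inj₁ vb rewrite ==⇒≡ vb | transpose-matchʳ a b = trans (inTriple-₁ a b c) (sym (inTriple-₂ a b c))
  ... | inj₂ va | inj₂ vb rewrite transpose-other a b v (==false⇒≢ va) (==false⇒≢ vb) = refl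

  transpose-fixes : ∀ a b c v → inTriple a b c v ≡ false → transpose a b v ≡ v
  transpose-fixes a b c v miss with va , vbc ← ∨-≡false miss with vb , _ ← ∨-≡false vbc =
    transpose-other a b v (==false⇒≢ va) (==false⇒≢ vb)

  transpose-is : ∀ (a b : Fin n) m → Maybe.map (transpose a b) m is a ≡ m is b
  transpose-is a b nothing = refl
  transpose-is a b (just v) with Bool-cases (v == a) | Bool-cases (v == b)
  ... | inj₁ va | _       rewrite ==⇒≡ va | transpose-matchˡ a b = ==-sym b a
  ... | inj₂ _  | inj₁ vb rewrite ==⇒≡ vb | transpose-matchʳ a b = trans (==-refl a) (sym (==-refl b))
  ... | inj₂ va | inj₂ vb rewrite transpose-other a b v (==false⇒≢ va) (==false⇒≢ vb) = trans va (sym vb)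

  pivotCount : Fin n → Fin n → Fin n → ℕ
  pivotCount a b c = sumOverPerms n (λ π → ⟦ triplePivot everyone a b c π is a ⟧)

  pivotCount-swap₂₃ : ∀ a b c → pivotCount a b c ≡ pivotCount a c b
  pivotCount-swap₂₃ a b c =
    ∑-cong (perms (allFin n)) λ π → cong (λ m → ⟦ m is a ⟧) (triplePivot-swap₂₃ everyone a b c π)

  pivotCount-swap₁₂ : ∀ a b c → pivotCount a b c ≡ pivotCount b a c
  pivotCount-swap₁₂ a b c = begin
    sumOverPerms n (λ π → ⟦ triplePivot everyone a b c π is a ⟧)
      ≡⟨ sumOverPerms-relabel n (Permutation.transpose a b) (λ π → ⟦ triplePivot everyone a b c π is a ⟧) ⟨
    sumOverPerms n (λ π → ⟦ triplePivot everyone a b c (map τ π) is a ⟧)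
      ≡⟨ ∑-cong (perms (allFin n)) (λ π → cong ⟦_⟧ (trans
           (cong (_is a) (triplePivot-map τ a b c (transpose-inTriple a b c) (transpose-fixes a b c) everyone π))
           (transpose-is a b (triplePivot everyone a b c π)))) ⟩
    sumOverPerms n (λ π → ⟦ triplePivot everyone a b c π is b ⟧)
      ≡⟨ ∑-cong (perms (allFin n)) (λ π → cong (λ m → ⟦ m is b ⟧) (triplePivot-cong everyone a b c b a c π
           (λ v → ∨-swapˡ (v == a) (v == b) (v == c)) (λ U → ∧-swapˡ (U a) (U b) (U c)))) ⟩
    sumOverPerms n (λ π → ⟦ triplePivot everyone b a c π is b ⟧) ∎
    where
    open ≡-Reasoning
    τ : Fin n → Fin n
    τ = transpose a b

  pivotCount-diagonal : ∀ a b → pivotCount a a b ≡ pivotCount a b b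
  pivotCount-diagonal a b =
    ∑-cong (perms (allFin n)) λ π → cong (λ m → ⟦ m is a ⟧) (triplePivot-diagonal everyone a b π)

-- Expected costs over all orderings

module _ {n : ℕ} (G : Graph n) where

  orderings : List (List (Fin n))
  orderings = perms (allFin n)

  vertices : List (Fin n)
  vertices = allFin n

  ∈-orderings⇒complete : ∀ {π} → π ∈ orderings → Complete π
  ∈-orderings⇒complete π∈ = ↭⇒complete (∈-perms⇒↭ (allFin n) π∈)

  edgePivot : List (Fin n) → Fin n → Fin n → Bool
  edgePivot π j x = adj G j x ∧ (triplePivot G everyone j x x π is j)

  wedgePivot : List (Fin n) → Fin n → Fin n → Fin n → Bool
  wedgePivot π v i j = openWedge G v i j ∧ (triplePivot G everyone v i j π is v)

  coverWeight : Fin n → Fin n → ℕ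
  coverWeight j x = ⟦ adj G j x ⟧ * pivotCount G j x x

  coverWeight-sym : ∀ j x → coverWeight j x ≡ coverWeight x j
  coverWeight-sym j x = cong₂ _*_ (cong ⟦_⟧ (Graph.sym G j x))
    (trans (pivotCount-swap₁₂ G j x x) (trans (pivotCount-swap₂₃ G x j x) (pivotCount-diagonal G x j)))

  ∑-coverWeight-≤ : ∀ x → ∑ vertices (λ j → coverWeight j x) ≤ numPerms n
  ∑-coverWeight-≤ x =
    ∑-disjoint-≤ orderings vertices (λ j → adj G j x) (λ π j → triplePivot G everyone j x x π is j) (Unique.allFin⁺ n) unique
    where
    unique : ∀ π j j′ → edgePivot π j x ≡ true → edgePivot π j′ x ≡ true → j ≡ j′
    unique π j j′ h h′ with jx , pj ← ∧-≡true h with j′x , pj′ ← ∧-≡true h′ =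
      triplePivot-unique G everyone π x x j j′ (cong (_∨ adj G j x) jx) (cong (_∨ adj G j′ x) j′x)
        (is⇒≡just _ j pj) (is⇒≡just _ j′ pj′)

  complement-card-≤ : ∀ {π} → Complete π →
    card (complement (greedyMIS G π)) ≤ ∑₂ (λ x j → ⟦ edgePivot π j x ⟧)
  complement-card-≤ {π} complete = ∑-mono vertices λ x _ → charged x
    where
    charged : ∀ x → ⟦ not (greedyMIS G π x) ⟧ ≤ ∑ vertices (λ j → ⟦ edgePivot π j x ⟧)
    charged x with greedyMIS G π x in x∈I
    ... | true  = z≤n
    ... | false with jx , first ← ∉MIS⇒pivot-of-pair G complete x x∈I =
      ∑-⟦⟧-≥1 vertices _ (∈-allFin (pivotClustering G π x)) (∧-is jx first)

  greedyMIS-vertexCover-bound : (C : VSet n) → VertexCover G C →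
    sumOverPerms n (λ π → card (complement (greedyMIS G π))) ≤ 2 * numPerms n * card C
  greedyMIS-vertexCover-bound C cover = begin
    ∑ orderings (λ π → card (complement (greedyMIS G π)))
      ≤⟨ ∑-mono orderings (λ π π∈ → complement-card-≤ (∈-orderings⇒complete π∈)) ⟩
    ∑ orderings (λ π → ∑₂ (λ x j → ⟦ edgePivot π j x ⟧))
      ≡⟨ ∑-⟦∧⟧-∑₂ orderings (λ x j → adj G j x) (λ π x j → triplePivot G everyone j x x π is j) ⟩
    ∑₂ (λ x j → coverWeight j x)
      ≤⟨ ∑₂-mono charge ⟩
    ∑₂ (λ x j → w x j + w j x)
      ≡⟨ ∑₂-+ w (λ x j → w j x) ⟩
    ∑₂ w + ∑₂ (λ x j → w j x)
      ≡⟨ cong (∑₂ w +_) (∑₂-flip w) ⟩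
    ∑₂ w + ∑₂ w
      ≤⟨ +-mono-≤ ∑₂w-≤ ∑₂w-≤ ⟩
    card C * numPerms n + card C * numPerms n
      ≡⟨ solve 2 (λ c p → c :* p :+ c :* p := con 2 :* p :* c) refl (card C) (numPerms n) ⟩
    2 * numPerms n * card C ∎
    where
    open ≤-Reasoning
    w : Fin n → Fin n → ℕ
    w x j = ⟦ C x ⟧ * coverWeight j x
    charge : ∀ x j → coverWeight j x ≤ w x j + w j x
    charge x j rewrite sym (coverWeight-sym j x) with Bool-cases (adj G j x)
    ... | inj₂ jx rewrite jx = z≤n
    ... | inj₁ jx = ≤-charge₂ (coverWeight j x) (C x) (C j) (Sum.swap (cover j x jx))
    ∑₂w-≤ : ∑₂ w ≤ card C * numPerms n
    ∑₂w-≤ = begin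
      ∑₂ w
        ≡⟨ ∑-cong vertices (λ x → ∑-*ˡ vertices ⟦ C x ⟧ (λ j → coverWeight j x)) ⟩
      ∑ vertices (λ x → ⟦ C x ⟧ * ∑ vertices (λ j → coverWeight j x))
        ≤⟨ ∑-mono vertices (λ x _ → *-monoʳ-≤ ⟦ C x ⟧ (∑-coverWeight-≤ x)) ⟩
      ∑ vertices (λ x → ⟦ C x ⟧ * numPerms n)
        ≡⟨ ∑-*ʳ vertices (numPerms n) (λ x → ⟦ C x ⟧) ⟩
      card C * numPerms n
        ∎

  Labelled : STCPlus G → Fin n → Fin n → Bool
  Labelled L a b = W L a b ∨ N L a b

  Labelled-sym : ∀ L a b → Labelled L a b ≡ Labelled L b a
  Labelled-sym L a b = cong₂ _∨_ (W-sym L a b) (N-sym L a b)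

  Labelled-irrefl : ∀ L a → Labelled L a a ≡ false
  Labelled-irrefl L a = cong₂ _∨_
    (¬-not λ w → true≢false (trans (sym (W⊆E L a a w)) (irrefl G a)))
    (¬-not λ m → true≢false (trans (sym (==-refl a)) (proj₂ (N⊆nonE L a a m))))

  W⇒Labelled : ∀ L {a b} → W L a b ≡ true → Labelled L a b ≡ true
  W⇒Labelled L w rewrite w = refl

  W⇒Labelled′ : ∀ L {a b} → W L b a ≡ true → Labelled L a b ≡ true
  W⇒Labelled′ L {a} {b} w = W⇒Labelled L (trans (W-sym L a b) w)

  N⇒Labelled : ∀ L {a b} → N L a b ≡ true → Labelled L a b ≡ true
  N⇒Labelled L {a} {b} m rewrite m = ∨-zeroʳ (W L a b)

  openWedge-covered : (L : STCPlus G) → ∀ v i j → openWedge G v i j ≡ true →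
    Labelled L i j ≡ true ⊎ Labelled L v i ≡ true ⊎ Labelled L v j ≡ true
  openWedge-covered L v i j h with v≢i , v≢j , i≢j , two ← openWedge-elim G h
                              with exactlyTwo-cases (adj G v i) (adj G v j) (adj G i j) two
  ... | inj₁ (vi , vj , ij) =
    Sum.[ inj₂ ∘ inj₁ ∘ W⇒Labelled L , Sum.[ inj₂ ∘ inj₂ ∘ W⇒Labelled L , inj₁ ∘ N⇒Labelled L ]′ ]′
      (wedge L v i j (≢⇒==false i≢j) vi vj ij)
  ... | inj₂ (inj₁ (vi , vj , ij)) =
    Sum.[ inj₂ ∘ inj₁ ∘ W⇒Labelled′ L , Sum.[ inj₁ ∘ W⇒Labelled L , inj₂ ∘ inj₂ ∘ N⇒Labelled L ]′ ]′
      (wedge L i v j (≢⇒==false v≢j) (trans (Graph.sym G i v) vi) ij vj)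
  ... | inj₂ (inj₂ (vi , vj , ij)) =
    Sum.[ inj₂ ∘ inj₂ ∘ W⇒Labelled′ L , Sum.[ inj₁ ∘ W⇒Labelled′ L , inj₂ ∘ inj₁ ∘ N⇒Labelled L ]′ ]′
      (wedge L j v i (≢⇒==false v≢i) (trans (Graph.sym G j v) vj) (trans (Graph.sym G j i) ij) vi)

  wedgeWeight : Fin n → Fin n → Fin n → ℕ
  wedgeWeight i j v = ⟦ openWedge G v i j ⟧ * pivotCount G v i j

  wedgeWeight-rotate : ∀ i j v → wedgeWeight v i j ≡ wedgeWeight i j v
  wedgeWeight-rotate i j v = cong₂ _*_
    (cong ⟦_⟧ (trans (openWedge-swap₁₂ G j v i) (openWedge-swap₂₃ G v j i)))
    (trans (pivotCount-swap₁₂ G j v i) (pivotCount-swap₂₃ G v j i))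

  wedgeWeight-reverse : ∀ i j v → wedgeWeight v j i ≡ wedgeWeight i j v
  wedgeWeight-reverse i j v = cong₂ _*_ (cong ⟦_⟧ (openWedge-swap₁₂ G i v j)) (pivotCount-swap₁₂ G i v j)

  ∑-wedgeWeight-≤ : ∀ i j → ∑ vertices (wedgeWeight i j) ≤ numPerms n
  ∑-wedgeWeight-≤ i j =
    ∑-disjoint-≤ orderings vertices (λ v → openWedge G v i j) (λ π v → triplePivot G everyone v i j π is v) (Unique.allFin⁺ n) unique
    where
    unique : ∀ π v v′ → wedgePivot π v i j ≡ true → wedgePivot π v′ i j ≡ true → v ≡ v′
    unique π v v′ h h′ with w , pv ← ∧-≡true h with w′ , pv′ ← ∧-≡true h′ =
      triplePivot-unique G everyone π i j v v′ (openWedge-adjacent G w) (openWedge-adjacent G w′)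
        (is⇒≡just _ v pv) (is⇒≡just _ v′ pv′)

  twice-cost-≤ : ∀ {π} → Complete π → 2 * inducedSTCCost G (pivotClustering G π) ≤
    ∑₃ (λ i j v → ⟦ wedgePivot π v i j ⟧)
  twice-cost-≤ {π} complete = begin
    2 * (countPairs (inducedW G c) + countPairs (inducedN G c))
      ≤⟨ *-monoʳ-≤ 2 (countPairs-∨-disjoint (inducedW G c) (inducedN G c) disjoint) ⟩
    2 * countPairs (Mistake G c)
      ≡⟨ countPairs-double (Mistake G c) (Mistake-sym G c) (Mistake-irrefl G c) ⟩
    ∑₂ (λ i j → ⟦ Mistake G c i j ⟧)
      ≤⟨ ∑₂-mono charged ⟩
    ∑₃ (λ i j v → ⟦ wedgePivot π v i j ⟧) ∎
    where
    open ≤-Reasoning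
    c : Fin n → Fin n
    c = pivotClustering G π
    disjoint : ∀ i j → inducedW G c i j ≡ true → inducedN G c i j ≡ false
    disjoint i j w rewrite proj₁ (∧-≡true {adj G i j} w) = refl
    charged : ∀ i j → ⟦ Mistake G c i j ⟧ ≤ ∑ vertices (λ v → ⟦ wedgePivot π v i j ⟧)
    charged i j with Mistake G c i j in m
    ... | false = z≤n
    ... | true with v , w , first ← mistake⇒wedge-pivot G complete i j m =
      ∑-⟦⟧-≥1 vertices _ (∈-allFin v) (∧-is w first)

  pivot-stc-bound : (L : STCPlus G) →
    sumOverPerms n (λ π → inducedSTCCost G (pivotClustering G π)) ≤ 3 * numPerms n * stcCost L
  -- Doubled because the charging counts each mistake once per orientation.
  pivot-stc-bound L = *-cancelˡ-≤ 2 (begin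
    2 * ∑ orderings cost
      ≡⟨ ∑-*ˡ orderings 2 cost ⟨
    ∑ orderings (λ π → 2 * cost π)
      ≤⟨ ∑-mono orderings (λ π π∈ → twice-cost-≤ (∈-orderings⇒complete π∈)) ⟩
    ∑ orderings (λ π → ∑₃ (λ i j v → ⟦ wedgePivot π v i j ⟧))
      ≡⟨ ∑-⟦∧⟧-∑₃ orderings (λ i j v → openWedge G v i j) (λ π i j v → triplePivot G everyone v i j π is v) ⟩
    ∑₃ wedgeWeight
      ≤⟨ ∑₃-mono charge ⟩
    ∑₃ (λ i j v → t i j v + (t v i j + t v j i))
      ≡⟨ trans (∑₃-+ t _) (cong (∑₃ t +_) (∑₃-+ (λ i j v → t v i j) (λ i j v → t v j i))) ⟩
    ∑₃ t + (∑₃ (λ i j v → t v i j) + ∑₃ (λ i j v → t v j i))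
      ≡⟨ cong (∑₃ t +_) (cong₂ _+_ (∑₃-rotate t) (∑₃-reverse t)) ⟩
    ∑₃ t + (∑₃ t + ∑₃ t)
      ≤⟨ +-mono-≤ ∑₃t-≤ (+-mono-≤ ∑₃t-≤ ∑₃t-≤) ⟩
    bound + (bound + bound)
      ≡⟨ solve 2 (λ c p → con 2 :* c :* p :+ (con 2 :* c :* p :+ con 2 :* c :* p) := con 2 :* (con 3 :* p :* c))
               refl (stcCost L) (numPerms n) ⟩
    2 * (3 * numPerms n * stcCost L) ∎)
    where
    open ≤-Reasoning
    cost : List (Fin n) → ℕ
    cost π = inducedSTCCost G (pivotClustering G π)
    t : Fin n → Fin n → Fin n → ℕ
    t a b c = ⟦ Labelled L a b ⟧ * wedgeWeight a b c
    bound : ℕ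
    bound = 2 * stcCost L * numPerms n
    charge : ∀ i j v → wedgeWeight i j v ≤ t i j v + (t v i j + t v j i)
    charge i j v rewrite wedgeWeight-rotate i j v | wedgeWeight-reverse i j v
      with Bool-cases (openWedge G v i j)
    ... | inj₂ ow rewrite ow = z≤n
    ... | inj₁ ow = ≤-charge₃ (wedgeWeight i j v) _ _ _ (openWedge-covered L v i j ow)
    ∑₃t-≤ : ∑₃ t ≤ bound
    ∑₃t-≤ = begin
      ∑₃ t
        ≡⟨ ∑₂-cong (λ a b → ∑-*ˡ vertices ⟦ Labelled L a b ⟧ (wedgeWeight a b)) ⟩
      ∑₂ (λ a b → ⟦ Labelled L a b ⟧ * ∑ vertices (wedgeWeight a b))
        ≤⟨ ∑₂-mono (λ a b → *-monoʳ-≤ ⟦ Labelled L a b ⟧ (∑-wedgeWeight-≤ a b)) ⟩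
      ∑₂ (λ a b → ⟦ Labelled L a b ⟧ * numPerms n)
        ≡⟨ trans (∑-cong vertices λ a → ∑-*ʳ vertices (numPerms n) (λ b → ⟦ Labelled L a b ⟧))
                 (∑-*ʳ vertices (numPerms n) _) ⟩
      ∑₂ (λ a b → ⟦ Labelled L a b ⟧) * numPerms n
        ≡⟨ cong (_* numPerms n) (countPairs-double (Labelled L) (Labelled-sym L) (Labelled-irrefl L)) ⟨
      2 * countPairs (Labelled L) * numPerms n
        ≤⟨ *-monoˡ-≤ (numPerms n) (*-monoʳ-≤ 2 (countPairs-∨ (W L) (N L))) ⟩
      bound ∎

  -- inducedN only adds i ≢ j, which countPairs already enforces through toℕ i < toℕ j.
  mistakes≡inducedSTCCost : ∀ c → mistakes G c ≡ inducedSTCCost G c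
  mistakes≡inducedSTCCost c = cong (countPairs (positiveMistake G c) +_) (∑₂-cong offDiagonal)
    where
    offDiagonal : ∀ i j →
      ⟦ (toℕ i <ᵇ toℕ j) ∧ negativeMistake G c i j ⟧ ≡ ⟦ (toℕ i <ᵇ toℕ j) ∧ inducedN G c i j ⟧
    offDiagonal i j with Bool-cases (i == j)
    ... | inj₁ i=j rewrite ==⇒≡ i=j | <ᵇ-false (≤-refl {toℕ j}) = refl
    ... | inj₂ i≠j rewrite i≠j | ∧-identityʳ (negativeMistake G c i j) = refl

  clusteringLabelling : (Fin n → Fin n) → STCPlus G
  clusteringLabelling c = record
    { W      = positiveMistake G c
    ; N      = inducedN G c
    ; W-sym  = λ i j → cong₂ (λ e s → e ∧ not s) (Graph.sym G i j) (==-sym (c i) (c j))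
    ; N-sym  = λ i j → cong₂ _∧_ (cong₂ (λ e s → not e ∧ s) (Graph.sym G i j) (==-sym (c i) (c j)))
                                 (cong not (==-sym i j))
    ; W⊆E    = λ i j w → proj₁ (∧-≡true w)
    ; N⊆nonE = λ i j m → let (neg , i≠j) = ∧-≡true m in
                         not-injective (proj₁ (∧-≡true neg)) , not-injective i≠j
    ; wedge  = clustered-wedge
    }
    where
    clustered-wedge : ∀ u v w → (v == w) ≡ false →
      adj G u v ≡ true → adj G u w ≡ true → adj G v w ≡ false →
      positiveMistake G c u v ≡ true ⊎ positiveMistake G c u w ≡ true ⊎ inducedN G c v w ≡ true
    clustered-wedge u v w v≠w uv uw ¬vw with Bool-cases (c u == c v) | Bool-cases (c u == c w)
    ... | inj₂ cu≠cv | _           rewrite uv | cu≠cv = inj₁ refl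
    ... | inj₁ _     | inj₂ cu≠cw  rewrite uw | cu≠cw = inj₂ (inj₁ refl)
    ... | inj₁ cu=cv | inj₁ cu=cw
      rewrite ¬vw | v≠w | ==⇒≡ cu=cv | ==⇒≡ cu=cw | ==-refl (c w) = inj₂ (inj₂ refl)

  pivot-cc-bound : (c : Fin n → Fin n) →
    sumOverPerms n (λ π → mistakes G (pivotClustering G π)) ≤ 3 * numPerms n * mistakes G c
  pivot-cc-bound c = subst₂ _≤_
    (∑-cong orderings (λ π → sym (mistakes≡inducedSTCCost (pivotClustering G π))))
    (cong (3 * numPerms n *_) (sym (mistakes≡inducedSTCCost c)))
    (pivot-stc-bound (clusteringLabelling c))

corollary2 : (n : ℕ) (G : Graph n) →
  -- (i) for every ordering of V, GreedyMIS returns a maximal independent set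
  ((π : List (Fin n)) → π ↭ allFin n → MaximalIndependent G (greedyMIS G π))
  -- (ii) V \ I is a vertex cover, and E|V \ I| ≤ 2 · (min vertex cover)
  × ((π : List (Fin n)) → π ↭ allFin n → VertexCover G (complement (greedyMIS G π)))
  × ((C : VSet n) → VertexCover G C →
       sumOverPerms n (λ π → card (complement (greedyMIS G π)))
         ≤ 2 * numPerms n * card C)
  -- (iii) pivot clustering: E[mistakes] ≤ 3 · OPT_CC
  × ((c : Fin n → Fin n) →
       sumOverPerms n (λ π → mistakes G (pivotClustering G π))
         ≤ 3 * numPerms n * mistakes G c)
  -- and E[cost of induced STC+ labeling] ≤ 3 · OPT_MinSTC+
  × ((L : STCPlus G) →
       sumOverPerms n (λ π → inducedSTCCost G (pivotClustering G π))
         ≤ 3 * numPerms n * stcCost L)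
corollary2 n G =
    (λ π π↭ → greedyMIS-maximalIndependent G (↭⇒complete π↭))
  , (λ π π↭ → independent⇒complement-cover G (proj₁ (greedyMIS-maximalIndependent G (↭⇒complete π↭))))
  , greedyMIS-vertexCover-bound G
  , pivot-cc-bound G
  , pivot-stc-bound G
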